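{- Let $\mathcal{X}$ be a regular $n$-premaniplex with automorphism group $\langle\rho_0,\dots,\rho_{n-1}\rangle$, where $\rho_0,\dots,\rho_{n-1}$ are the distinguished generators with respect to a base vertex, and let $(\mathcal{Y},\eta)$ be an $(n,m)$-voltage operator. Then $\mathcal{X}\rtimes_\eta\mathcal{Y}$ is isomorphic to the derived graph $\mathcal{Y}^\nu$, where $\nu:\Pi(\mathcal{Y})\to\mathrm{Aut}(\mathcal{X})$ is the voltage assignment obtained from $\eta$ by replacing each $r_i$ with $\rho_i$ (i.e. $\nu=\pi\circ\eta$ for the homomorphism $\pi:\mathrm{Mon}(\mathcal{U}^n)\to\mathrm{Aut}(\mathcal{X})$ with $\pi(r_i)=\rho_i$).
   Context: Graphs may have semiedges and parallel edges. An $n$-premaniplex is a graph whose darts are colored by $\{0,\dots,n-1\}$ (a dart and its inverse have the same color) such that every vertex is the starting point of exactly one dart of each color, and for $|i-j|\ge 2$ every path of length 4 alternating colors $i,j$ is closed. For a vertex $x$, ${}^i x$ denotes the dart of color $i$ starting at $x$, and $x^i$ its endpoint. Automorphisms act on the right; $\mathcal X$ is regular if $\mathrm{Aut}(\mathcal X)$ acts transitively on vertices, and for a base vertex $\Phi$ the distinguished generator $\rho_i$ is the automorphism mapping $\Phi$ to $\Phi^i$. The group $\mathrm{Mon}(\mathcal U^n)=\langle r_0,\dots,r_{n-1}\mid r_i^2=1,\ (r_ir_j)^2=1 \text{ for } |i-j|\ge2\rangle$ acts on the left on the vertex set of every $n$-premaniplex by $r_i x=x^i$. A voltage assignment $\eta$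 with group $G$ assigns $\eta(d)\in G$ to each dart $d$ with $\eta(d^{ -1})=\eta(d)^{ -1}$; the voltage of a path $d_1\cdots d_k$ is $\eta(d_k)\cdots\eta(d_1)$. The derived graph $\mathcal Y^\nu$ of a premaniplex with voltage assignment $\nu$ in group $G$ has vertex set $V(\mathcal Y)\times G$ and $(y,g)^i=(y^i,\nu({}^i y)g)$. An $(n,m)$-voltage operator is a pair $(\mathcal Y,\eta)$ with $\mathcal Y$ an $m$-premaniplex and $\eta$ a voltage assignment with group $\mathrm{Mon}(\mathcal U^n)$ such that every length-4 path alternating between colors $i,j$ with $|i-j|\ge2$ has trivial voltage. For an $n$-premaniplex $\mathcal X$, $\mathcal X\rtimes_\eta\mathcal Y$ is the $m$-premaniplex on $V(\mathcal X)\times V(\mathcal Y)$ where for each color $i$ there is an edge of color $i$ joining $(x,y)$ and $(\eta({}^i y)x,\ y^i)$. -}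

module Defs where

open import Data.Nat using (ℕ; _≤_; _+_)
open import Data.Fin using (Fin; toℕ)
open import Data.List using (List; []; _∷_; _++_; reverse)
open import Data.Product using (Σ; ∃; _×_; _,_; proj₁; proj₂)
open import Data.Sum using (_⊎_)
open import Function using (_∘_; id)
open import Relation.Binary.PropositionalEquality
  using (_≡_; refl; sym; trans; cong; cong₂; subst)

Far : ∀ {n} → Fin n → Fin n → Set
Far i j = (2 + toℕ i ≤ toℕ j) ⊎ (2 + toℕ j ≤ toℕ i)

-- Since every vertex is the start of exactly one dart
-- of each colour, a premaniplex is the same as a vertex set with, for each
-- colour i, the map x ↦ x^i (endpoint of the i-dart ⁱx).  The dart ⁱx is
-- identified with the pair (x , i); its inverse is ⁱ(x^i), so
-- (x^i)^i = x; semiedges are the fixed points x^i = x, parallel edges are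
-- allowed.

record Premaniplex (n : ℕ) : Set₁ where
  field
    V       : Set
    r       : Fin n → V → V
    r-invol : ∀ i x → r i (r i x) ≡ x
    r-comm  : ∀ i j → Far i j → ∀ x → r j (r i (r j (r i x))) ≡ x

open Premaniplex public

-- Mon(U^n) = ⟨ r_0 … r_{n-1} | r_i² , (r_i r_j)² for |i-j| ≥ 2 ⟩,
-- presented as words (the word a₁ … a_k stands for r_{a₁} ⋯ r_{a_k};
-- product = concatenation, inverse = reverse since the generators are
-- involutions) modulo the congruence generated by the relators.

Word : ℕ → Set
Word n = List (Fin n)

infix 4 _≈M_
data _≈M_ {n : ℕ} : Word n → Word n → Set where
  ≈refl  : ∀ {u} → u ≈M u
  ≈sym   : ∀ {u v} → u ≈M v → v ≈M u
  ≈trans : ∀ {u v w} → u ≈M v → v ≈M w → u ≈M w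
  rel-sq   : ∀ u v i → (u ++ i ∷ i ∷ v) ≈M (u ++ v)
  rel-comm : ∀ u v i j → Far i j → (u ++ i ∷ j ∷ i ∷ j ∷ v) ≈M (u ++ v)

act : ∀ {n} (X : Premaniplex n) → Word n → V X → V X
act X []      x = x
act X (a ∷ w) x = r X a (act X w x)

-- Automorphisms (colour-preserving graph automorphisms), acting on the
-- right: x φ = f φ x, so x (φ ψ) = (x φ) ψ.

record Aut {n} (X : Premaniplex n) : Set where
  field
    f    : V X → V X
    g    : V X → V X
    f∘g  : ∀ x → f (g x) ≡ x
    g∘f  : ∀ x → g (f x) ≡ x
    pres : ∀ i x → f (r X i x) ≡ r X i (f x)

module _ {n} {X : Premaniplex n} where

  infix 4 _≈A_
  _≈A_ : Aut X → Aut X → Set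
  φ ≈A ψ = ∀ x → Aut.f φ x ≡ Aut.f ψ x

  idA : Aut X
  idA = record { f = id ; g = id ; f∘g = λ _ → refl ; g∘f = λ _ → refl
               ; pres = λ _ _ → refl }

  infixl 7 _⊙_
  _⊙_ : Aut X → Aut X → Aut X
  φ ⊙ ψ = record
    { f    = Aut.f ψ ∘ Aut.f φ
    ; g    = Aut.g φ ∘ Aut.g ψ
    ; f∘g  = λ x → trans (cong (Aut.f ψ) (Aut.f∘g φ (Aut.g ψ x))) (Aut.f∘g ψ x)
    ; g∘f  = λ x → trans (cong (Aut.g φ) (Aut.g∘f ψ (Aut.f φ x))) (Aut.g∘f φ x)
    ; pres = λ i x → trans (cong (Aut.f ψ) (Aut.pres φ i x)) (Aut.pres ψ i (Aut.f φ x))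
    }

IsRegular : ∀ {n} → Premaniplex n → Set
IsRegular X = ∀ x y → ∃ λ (φ : Aut X) → Aut.f φ x ≡ y

Distinguished : ∀ {n} (X : Premaniplex n) → V X → (Fin n → Aut X) → Set
Distinguished X Φ ρ = ∀ i → Aut.f (ρ i) Φ ≡ r X i Φ

πρ : ∀ {n} {X : Premaniplex n} → (Fin n → Aut X) → Word n → Aut X
πρ ρ []      = idA
πρ ρ (a ∷ w) = ρ a ⊙ πρ ρ w

GeneratedBy : ∀ {n} (X : Premaniplex n) → (Fin n → Aut X) → Set
GeneratedBy X ρ = ∀ (φ : Aut X) → ∃ λ (w : Word _) → φ ≈A πρ ρ w

-- (n,m)-voltage operators.  η(ⁱy) is written η y i.  The inverse of the
-- dart ⁱy is ⁱ(y^i); the voltage of a path d₁⋯d_k is η(d_k)⋯η(d₁).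

record VoltageOperator (n m : ℕ) : Set₁ where
  field
    Y     : Premaniplex m
    η     : V Y → Fin m → Word n
    η-inv : ∀ y i → η (r Y i y) i ≈M reverse (η y i)
    η-comm : ∀ i j → Far i j → ∀ y →
      (η (r Y i (r Y j (r Y i y))) j ++ η (r Y j (r Y i y)) i
        ++ η (r Y i y) j ++ η y i) ≈M []

-- Colour graphs over a setoid of vertices (needed because the vertex set
-- of a derived graph with group Aut(X) involves automorphisms, whose
-- equality is pointwise).

record ColGraph (m : ℕ) : Set₁ where
  field
    C     : Set
    _≈_   : C → C → Set
    ≈-refl  : ∀ {a} → a ≈ a
    ≈-sym   : ∀ {a b} → a ≈ b → b ≈ a
    ≈-trans : ∀ {a b c} → a ≈ b → b ≈ c → a ≈ c
    rc    : Fin m → C → C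
    rc-cong : ∀ i {a b} → a ≈ b → rc i a ≈ rc i b

record Iso {m} (A B : ColGraph m) : Set where
  private
    module A = ColGraph A
    module B = ColGraph B
  field
    to      : A.C → B.C
    from    : B.C → A.C
    to-cong   : ∀ {a a'} → a A.≈ a' → to a B.≈ to a'
    from-cong : ∀ {b b'} → b B.≈ b' → from b A.≈ from b'
    to∘from : ∀ b → to (from b) B.≈ b
    from∘to : ∀ a → from (to a) A.≈ a
    to-col  : ∀ i a → to (A.rc i a) B.≈ B.rc i (to a)

semidirect : ∀ {n m} (X : Premaniplex n) (O : VoltageOperator n m) → ColGraph m
semidirect X O = record
  { C = V X × V Y
  ; _≈_ = _≡_
  ; ≈-refl = refl ; ≈-sym = sym ; ≈-trans = trans
  ; rc = λ i p → act X (η (proj₂ p) i) (proj₁ p) , r Y i (proj₂ p)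
  ; rc-cong = λ i eq → cong (λ p → act X (η (proj₂ p) i) (proj₁ p) , r Y i (proj₂ p)) eq
  }
  where open VoltageOperator O

derived : ∀ {n m} (X : Premaniplex n) (Y : Premaniplex m)
          (ν : V Y → Fin m → Aut X) → ColGraph m
derived X Y ν = record
  { C = V Y × Aut X
  ; _≈_ = λ p q → (proj₁ p ≡ proj₁ q) × (proj₂ p ≈A proj₂ q)
  ; ≈-refl = refl , λ _ → refl
  ; ≈-sym = λ { (e , h) → sym e , λ x → sym (h x) }
  ; ≈-trans = λ { (e , h) (e' , h') → trans e e' , λ x → trans (h x) (h' x) }
  ; rc = λ i p → r Y i (proj₁ p) , ν (proj₁ p) i ⊙ proj₂ p
  ; rc-cong = λ { i {y , φ} {.y , ψ} (refl , h) →
        refl , λ x → h (Aut.f (ν y i) x) }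
  }

νOf : ∀ {n m} {X : Premaniplex n} → (Fin n → Aut X) → (O : VoltageOperator n m) →
      V (VoltageOperator.Y O) → Fin m → Aut X
νOf ρ O y i = πρ ρ (VoltageOperator.η O y i)

{-# OPTIONS --safe #-}
module Submission where

-- Regularity together with Aut(X) = ⟨ρ⟩ makes X connected, so an automorphism
-- is determined by the image of the base vertex Φ.  Hence x ↦ φₓ, the unique
-- automorphism with Φ φₓ = x, identifies V(X) with Aut(X).  Since automorphisms
-- commute with the monodromy action and Φ π(w) = w Φ, we get
-- Φ (π(w) φₓ) = w x, i.e. φ_{w x} = π(w) φₓ.  So (x , y) ↦ (y , φₓ) turns the
-- edge (x , y) — (η(ⁱy) x , yⁱ) of X ⋊_η Y into the edge (y , φₓ) — (yⁱ , ν(ⁱy) φₓ)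
-- of Y^ν.

open import Defs
open import Relation.Binary.PropositionalEquality
  using (_≡_; refl; sym; trans; cong; module ≡-Reasoning)
open import Data.Fin using (Fin)
open import Data.List using ([]; _∷_)
open import Data.Product using (∃; _,_; proj₁; proj₂)

module _ {n} {X : Premaniplex n} where

  Aut-f-act : ∀ (φ : Aut X) w x → Aut.f φ (act X w x) ≡ act X w (Aut.f φ x)
  Aut-f-act φ []      x = refl
  Aut-f-act φ (a ∷ w) x = trans (Aut.pres φ a (act X w x)) (cong (r X a) (Aut-f-act φ w x))

  πρ-base : ∀ {Φ ρ} → Distinguished X Φ ρ → ∀ w → Aut.f (πρ ρ w) Φ ≡ act X w Φ
  πρ-base dist []               = refl
  πρ-base {Φ} {ρ} dist (a ∷ w) = begin
    Aut.f (πρ ρ w) (Aut.f (ρ a) Φ) ≡⟨ cong (Aut.f (πρ ρ w)) (dist a) ⟩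
    Aut.f (πρ ρ w) (r X a Φ)       ≡⟨ Aut.pres (πρ ρ w) a Φ ⟩
    r X a (Aut.f (πρ ρ w) Φ)       ≡⟨ cong (r X a) (πρ-base dist w) ⟩
    r X a (act X w Φ)              ∎
    where open ≡-Reasoning

  Reachable-from : V X → Set
  Reachable-from Φ = ∀ x → ∃ λ w → act X w Φ ≡ x

  regular⇒reachable : ∀ {Φ ρ} → IsRegular X → Distinguished X Φ ρ → GeneratedBy X ρ →
                      Reachable-from Φ
  regular⇒reachable {Φ} {ρ} reg dist gen x with reg Φ x
  ... | φ , Φφ≡x with gen φ
  ...   | w , φ≈πw = w , (begin
    act X w Φ          ≡⟨ sym (πρ-base dist w) ⟩
    Aut.f (πρ ρ w) Φ   ≡⟨ sym (φ≈πw Φ) ⟩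
    Aut.f φ Φ          ≡⟨ Φφ≡x ⟩
    x                  ∎)
    where open ≡-Reasoning

  ≈A-at-base : ∀ {Φ} → Reachable-from Φ → ∀ φ ψ → Aut.f φ Φ ≡ Aut.f ψ Φ → φ ≈A ψ
  ≈A-at-base {Φ} reach φ ψ φΦ≡ψΦ x with reach x
  ... | w , refl = begin
    Aut.f φ (act X w Φ)  ≡⟨ Aut-f-act φ w Φ ⟩
    act X w (Aut.f φ Φ)  ≡⟨ cong (act X w) φΦ≡ψΦ ⟩
    act X w (Aut.f ψ Φ)  ≡⟨ sym (Aut-f-act ψ w Φ) ⟩
    Aut.f ψ (act X w Φ)  ∎
    where open ≡-Reasoning

corollary5p6 : ∀ {n m} (X : Premaniplex n) (Φ : V X) (ρ : Fin n → Aut X) →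
    IsRegular X → Distinguished X Φ ρ → GeneratedBy X ρ →
    (O : VoltageOperator n m) →
    Iso (semidirect X O) (derived X (VoltageOperator.Y O) (νOf ρ O))
corollary5p6 X Φ ρ reg dist gen O = record
  { to        = λ { (x , y) → y , frame x }
  ; from      = λ { (y , φ) → Aut.f φ Φ , y }
  ; to-cong   = λ { refl → refl , λ _ → refl }
  ; from-cong = λ { {y , φ} {.y , ψ} (refl , φ≈ψ) → cong (_, y) (φ≈ψ Φ) }
  ; to∘from   = λ { (y , φ) → refl , agree (frame (Aut.f φ Φ)) φ (frame-base _) }
  ; from∘to   = λ { (x , y) → cong (_, y) (frame-base x) }
  ; to-col    = λ { i (x , y) → refl , frame-act (η y i) x }
  }
  where
  open VoltageOperator O
  open ≡-Reasoning

  frame : V X → Aut X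
  frame x = proj₁ (reg Φ x)

  frame-base : ∀ x → Aut.f (frame x) Φ ≡ x
  frame-base x = proj₂ (reg Φ x)

  agree : ∀ φ ψ → Aut.f φ Φ ≡ Aut.f ψ Φ → φ ≈A ψ
  agree = ≈A-at-base (regular⇒reachable reg dist gen)

  frame-act : ∀ w x → frame (act X w x) ≈A πρ ρ w ⊙ frame x
  frame-act w x = agree (frame (act X w x)) (πρ ρ w ⊙ frame x) (begin
    Aut.f (frame (act X w x)) Φ        ≡⟨ frame-base (act X w x) ⟩
    act X w x                          ≡⟨ cong (act X w) (sym (frame-base x)) ⟩
    act X w (Aut.f (frame x) Φ)        ≡⟨ sym (Aut-f-act (frame x) w Φ) ⟩
    Aut.f (frame x) (act X w Φ)        ≡⟨ cong (Aut.f (frame x)) (sym (πρ-base dist w)) ⟩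
    Aut.f (frame x) (Aut.f (πρ ρ w) Φ) ∎)
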